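{- For every permutation $\pi$, $$\bigcup_{u\in P(\pi),\ u\text{ strict or quasi-strict}}\mathcal{L}(u)=A^\star\cdot E_\pi^{\textsc{s}}\cdot A^\star\ \cup\ A^\star\cdot\mathcal{M}_2\cdot A^\star\cdot E_\pi^{\textsc{qs}}\cdot A^\star,$$ where $E_\pi^{\textsc{s}}=\{\phi(u): u\in P(\pi),\ u\text{ strict}\}$ (with $\phi(u)$ contributing both of its words when $|u|=1$) and $E_\pi^{\textsc{qs}}=\{\phi(u^{(2)}): u=u^{(1)}u^{(2)}\in P(\pi),\ u\text{ quasi-strict}\}$.
   Context: Pin words: a pin representation of a permutation is a sequence of points $(p_1,\dots,p_n)$, no two on a common horizontal or vertical line, order-isomorphic to its diagram, such that each $p_i$ ($i\ge2$) lies outside the bounding box of $\{p_1,\dots,p_{i-1}\}$ and either separates $p_{i-1}$ from $\{p_1,\dots,p_{i-2}\}$ (by the horizontal or vertical line through $p_i$) or does not separate $\{p_1,\dots,p_{i-1}\}$ into two nonempty sets. Choosing an origin $p_0$ with $(p_0,\dots,p_n)$ satisfying the same conditions, encode $p_i$ ($i\ge1$) by $U/D/L/R$ if $p_i$ separates $p_{i-1}$ from $\{p_0,\dots,p_{i-2}\}$ from the top/bottom/left/right, and by $1/2/3/4$ if $p_i$ does not separate $\{p_0,\dots,p_{i-1}\}$ and lies up-right/up-left/bottom-left/bottom-right of their bounding box. $P(\pi)$ is the set of pin words of $\pi$. A strict (resp. quasi-strict) pin word consists of one (resp. two) numerals followed only by directions $U,D,L,R$. Cutting a pin word $u$ before each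 numeral gives its strong numeral-led factor decomposition $u=u^{(1)}\cdots u^{(j)}$ (for quasi-strict $u$, $u^{(1)}$ is the first numeral and $u^{(2)}$ the rest). $A=\{U,D,L,R\}$, $\mathcal{M}_2=\{UR,UL,DR,DL,RU,RD,LU,LD\}$. $\phi$ maps a strict pin word $u=u'u''$, $|u'|=2$, to $\varphi(u')u''$ with $\varphi$: $1R\mapsto RUR$, $1L\mapsto RUL$, $1U\mapsto URU$, $1D\mapsto URD$, $2R\mapsto LUR$, $2L\mapsto LUL$, $2U\mapsto ULU$, $2D\mapsto ULD$, $3R\mapsto LDR$, $3L\mapsto LDL$, $3U\mapsto DLU$, $3D\mapsto DLD$, $4R\mapsto RDR$, $4L\mapsto RDL$, $4U\mapsto DRU$, $4D\mapsto DRD$, and single numerals to sets $\phi(1)=\{UR,RU\}$, $\phi(2)=\{UL,LU\}$, $\phi(3)=\{DL,LD\}$, $\phi(4)=\{RD,DR\}$. $\mathcal{L}(u)=A^\star\phi(u^{(1)})A^\star\cdots A^\star\phi(u^{(j)})A^\star$. -}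

module Defs where

open import Data.Nat using (ℕ; zero; suc; _≤_) renaming (_<_ to _<ℕ_)
open import Data.Integer using (ℤ) renaming (_<_ to _<ℤ_)
open import Data.Fin using (Fin; toℕ) renaming (_<_ to _<F_)
open import Data.Fin.Permutation using (Permutation′; _⟨$⟩ʳ_)
open import Data.List using (List; []; _∷_; _++_; length)
open import Data.List.Membership.Propositional using (_∈_)
open import Data.Product using (Σ; ∃; ∃₂; _×_; _,_; proj₁; proj₂)
open import Data.Sum using (_⊎_)
open import Data.Unit using (⊤)
open import Relation.Binary.PropositionalEquality using (_≡_; _≢_)

data Num : Set where
  one two three four : Num

data Dir : Set where
  U D L R : Dir

data Letter : Set where
  num : Num → Letter
  dir : Dir → Letter

dirs : List Dir → List Letter
dirs [] = []
dirs (d ∷ ds) = dir d ∷ dirs ds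

-- Points in the plane (integer coordinates suffice: all notions are
-- order-theoretic)

Point : Set
Point = ℤ × ℤ

X Y : Point → ℤ
X = proj₁
Y = proj₂

-- A finite sequence of points is given as q : ℕ → Point, of which only
-- an initial segment is relevant.  In what follows, "k" refers to the new
-- point q (suc k); the previous point is q k; the earlier points are
-- q j with j ≤ k, and q j with j < k are those before the previous one.

Outside : (ℕ → Point) → ℕ → Set
Outside q k =
    (∀ j → j ≤ k → X (q j) <ℤ X (q (suc k)))
  ⊎ (∀ j → j ≤ k → X (q (suc k)) <ℤ X (q j))
  ⊎ (∀ j → j ≤ k → Y (q j) <ℤ Y (q (suc k)))
  ⊎ (∀ j → j ≤ k → Y (q (suc k)) <ℤ Y (q j))

VSep : (ℕ → Point) → ℕ → Set
VSep q k =
    (X (q k) <ℤ X (q (suc k)) × (∀ j → j <ℕ k → X (q (suc k)) <ℤ X (q j)))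
  ⊎ (X (q (suc k)) <ℤ X (q k) × (∀ j → j <ℕ k → X (q j) <ℤ X (q (suc k))))

HSep : (ℕ → Point) → ℕ → Set
HSep q k =
    (Y (q k) <ℤ Y (q (suc k)) × (∀ j → j <ℕ k → Y (q (suc k)) <ℤ Y (q j)))
  ⊎ (Y (q (suc k)) <ℤ Y (q k) × (∀ j → j <ℕ k → Y (q j) <ℤ Y (q (suc k))))

Sep : (ℕ → Point) → ℕ → Set
Sep q k = HSep q k ⊎ VSep q k

NoSplit : (ℕ → Point) → ℕ → Set
NoSplit q k =
    ((∀ j → j ≤ k → X (q j) <ℤ X (q (suc k))) ⊎ (∀ j → j ≤ k → X (q (suc k)) <ℤ X (q j)))
  × ((∀ j → j ≤ k → Y (q j) <ℤ Y (q (suc k))) ⊎ (∀ j → j ≤ k → Y (q (suc k)) <ℤ Y (q j)))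

IsPinSeq : ℕ → (ℕ → Point) → Set
IsPinSeq m q = ∀ k → suc k <ℕ m → Outside q k × (Sep q k ⊎ NoSplit q k)

GenPos : ℕ → (ℕ → Point) → Set
GenPos n p = ∀ a b → a ≤ n → b ≤ n → a ≢ b → X (p a) ≢ X (p b) × Y (p a) ≢ Y (p b)

OrderIso : (n : ℕ) → Permutation′ n → (ℕ → Point) → Set
OrderIso n π p = Σ (Permutation′ n) λ σ → ∀ (a b : Fin n) →
    (X (P a) <ℤ X (P b) → σ ⟨$⟩ʳ a <F σ ⟨$⟩ʳ b)
  × (σ ⟨$⟩ʳ a <F σ ⟨$⟩ʳ b → X (P a) <ℤ X (P b))
  × (Y (P a) <ℤ Y (P b) → π ⟨$⟩ʳ (σ ⟨$⟩ʳ a) <F π ⟨$⟩ʳ (σ ⟨$⟩ʳ b))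
  × (π ⟨$⟩ʳ (σ ⟨$⟩ʳ a) <F π ⟨$⟩ʳ (σ ⟨$⟩ʳ b) → Y (P a) <ℤ Y (P b))
  where
  P : Fin n → Point
  P a = p (suc (toℕ a))

Enc : (ℕ → Point) → ℕ → Letter → Set
Enc p k (num one)   = ∀ j → j ≤ k → X (p j) <ℤ X (p (suc k)) × Y (p j) <ℤ Y (p (suc k))
Enc p k (num two)   = ∀ j → j ≤ k → X (p (suc k)) <ℤ X (p j) × Y (p j) <ℤ Y (p (suc k))
Enc p k (num three) = ∀ j → j ≤ k → X (p (suc k)) <ℤ X (p j) × Y (p (suc k)) <ℤ Y (p j)
Enc p k (num four)  = ∀ j → j ≤ k → X (p j) <ℤ X (p (suc k)) × Y (p (suc k)) <ℤ Y (p j)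
Enc p k (dir U) = 1 ≤ k × (∀ j → j ≤ k → Y (p j) <ℤ Y (p (suc k))) × VSep p k
Enc p k (dir D) = 1 ≤ k × (∀ j → j ≤ k → Y (p (suc k)) <ℤ Y (p j)) × VSep p k
Enc p k (dir L) = 1 ≤ k × (∀ j → j ≤ k → X (p (suc k)) <ℤ X (p j)) × HSep p k
Enc p k (dir R) = 1 ≤ k × (∀ j → j ≤ k → X (p j) <ℤ X (p (suc k))) × HSep p k

EncWord : (ℕ → Point) → ℕ → List Letter → Set
EncWord p k [] = ⊤
EncWord p k (ℓ ∷ u) = Enc p k ℓ × EncWord p (suc k) u

-- u ∈ P(π): u encodes a pin representation (p 1, …, p n) of π together
-- with an origin p 0
InP : (n : ℕ) → Permutation′ n → List Letter → Set
InP n π u = Σ (ℕ → Point) λ p →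
    GenPos n p
  × OrderIso n π p
  × IsPinSeq n (λ k → p (suc k))
  × IsPinSeq (suc n) p
  × length u ≡ n
  × EncWord p 0 u

IsStrict : List Letter → Set
IsStrict u = ∃₂ λ (a : Num) (ds : List Dir) → u ≡ num a ∷ dirs ds

IsQuasiStrict : List Letter → Set
IsQuasiStrict u = ∃₂ λ (a b : Num) → ∃ λ (ds : List Dir) → u ≡ num a ∷ num b ∷ dirs ds

varphi : Num → Dir → List Dir
varphi one   R = R ∷ U ∷ R ∷ []
varphi one   L = R ∷ U ∷ L ∷ []
varphi one   U = U ∷ R ∷ U ∷ []
varphi one   D = U ∷ R ∷ D ∷ []
varphi two   R = L ∷ U ∷ R ∷ []
varphi two   L = L ∷ U ∷ L ∷ []
varphi two   U = U ∷ L ∷ U ∷ []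
varphi two   D = U ∷ L ∷ D ∷ []
varphi three R = L ∷ D ∷ R ∷ []
varphi three L = L ∷ D ∷ L ∷ []
varphi three U = D ∷ L ∷ U ∷ []
varphi three D = D ∷ L ∷ D ∷ []
varphi four  R = R ∷ D ∷ R ∷ []
varphi four  L = R ∷ D ∷ L ∷ []
varphi four  U = D ∷ R ∷ U ∷ []
varphi four  D = D ∷ R ∷ D ∷ []

-- φ of the strict pin word  num a ∷ dirs ds, as a (finite) set of words
phi : Num → List Dir → List (List Dir)
phi one   [] = (U ∷ R ∷ []) ∷ (R ∷ U ∷ []) ∷ []
phi two   [] = (U ∷ L ∷ []) ∷ (L ∷ U ∷ []) ∷ []
phi three [] = (D ∷ L ∷ []) ∷ (L ∷ D ∷ []) ∷ []
phi four  [] = (R ∷ D ∷ []) ∷ (D ∷ R ∷ []) ∷ []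
phi a (d ∷ ds) = (varphi a d ++ ds) ∷ []

Lang : Set₁
Lang = List Dir → Set

Astar : Lang
Astar w = ⊤

infixr 6 _·_
_·_ : Lang → Lang → Lang
(L₁ · L₂) w = ∃₂ λ w₁ w₂ → w ≡ w₁ ++ w₂ × L₁ w₁ × L₂ w₂

⟦_⟧ : List (List Dir) → Lang
⟦ ws ⟧ w = w ∈ ws

M₂ : Lang
M₂ = ⟦ (U ∷ R ∷ []) ∷ (U ∷ L ∷ []) ∷ (D ∷ R ∷ []) ∷ (D ∷ L ∷ [])
     ∷ (R ∷ U ∷ []) ∷ (R ∷ D ∷ []) ∷ (L ∷ U ∷ []) ∷ (L ∷ D ∷ []) ∷ [] ⟧

-- a factor  num a ∷ dirs ds  is represented by (a , ds)
Factor : Set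
Factor = Num × List Dir

-- returns the leading directions (empty for pin words, which start with
-- a numeral) and the numeral-led factors
decomp : List Letter → List Dir × List Factor
decomp [] = [] , []
decomp (dir d ∷ w) = (d ∷ proj₁ (decomp w)) , proj₂ (decomp w)
decomp (num a ∷ w) = [] , ((a , proj₁ (decomp w)) ∷ proj₂ (decomp w))

𝓛F : List Factor → Lang
𝓛F [] = Astar
𝓛F ((a , ds) ∷ fs) = Astar · ⟦ phi a ds ⟧ · 𝓛F fs

𝓛 : List Letter → Lang
𝓛 u = 𝓛F (proj₂ (decomp u))

UnionL : (n : ℕ) → Permutation′ n → Lang
UnionL n π w = ∃ λ u → InP n π u × (IsStrict u ⊎ IsQuasiStrict u) × 𝓛 u w

Es : (n : ℕ) → Permutation′ n → Lang
Es n π w = ∃₂ λ (a : Num) (ds : List Dir) → InP n π (num a ∷ dirs ds) × ⟦ phi a ds ⟧ w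

Eqs : (n : ℕ) → Permutation′ n → Lang
Eqs n π w = ∃₂ λ (a b : Num) → ∃ λ (ds : List Dir) →
  InP n π (num a ∷ num b ∷ dirs ds) × ⟦ phi b ds ⟧ w

module Submission where

-- Unfolding the strong numeral-led factor decomposition, a
-- strict word  a·ds  has 𝓛 = A⋆ φ(a ds) A⋆, and a quasi-strict word
-- a·b·ds  has 𝓛 = A⋆ φ(a) A⋆ φ(b ds) A⋆, where φ(a) ranges over the two
-- words of M₂ attached to the numeral a; every word of M₂ arises this way.
-- The strict words give A⋆ E^s A⋆ directly.  For the quasi-strict words the
-- only non-formal point is that the first numeral of a quasi-strict pin
-- word of π can be changed at will (lemma  reorigin ): double all
-- coordinates of the pin representation and put the origin immediately
-- beside p 1, in the quadrant demanded by the new numeral.  The new origin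
-- then compares with p 2, p 3, … exactly as p 1 does, so all conditions
-- beyond the first letter carry over.

open import Defs
open import Data.Nat using (ℕ; zero; suc; z≤n; s≤s) renaming (_≤_ to _≤ℕ_; _<_ to _<ℕ_)
open import Data.Fin.Permutation using (Permutation′)
open import Data.List using (List; []; _∷_)
open import Data.List.Relation.Unary.Any using (here; there)
open import Data.Product using (_×_; _,_; proj₁; proj₂; Σ)
open import Data.Sum using (_⊎_; inj₁; inj₂) renaming (map to ⊎-map)
open import Data.Unit using (tt)
open import Data.Empty using (⊥-elim)
open import Function using (id; _∘_)
open import Relation.Binary.PropositionalEquality
  using (_≡_; _≢_; refl; sym; subst; subst₂; cong; ≢-sym)
open import Relation.Binary.Definitions using (tri<; tri≈; tri>)
open import Data.Integer using (ℤ; pred; 1ℤ) renaming (_+_ to _+ℤ_; _<_ to _<ℤ_; suc to sucℤ)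
open import Data.Integer.Properties
  using (<-cmp; <⇒≢; <-irrefl; <-asym; ≤-<-trans; <-≤-trans; <-trans; ≤-refl;
         +-mono-<; +-mono-≤; +-monoʳ-<; +-monoˡ-≤; +-assoc; pred-+;
         i<j⇒suc[i]≤j; suc[i]≤j⇒i<j; i≤suc[i]; i≤pred[j]⇒i<j; i<j⇒i≤pred[j])

-- Doubling coordinates leaves the odd integers free for new points.
dbl : ℤ → ℤ
dbl x = x +ℤ x

dbl-< : ∀ {x y} → x <ℤ y → dbl x <ℤ dbl y
dbl-< x<y = +-mono-< x<y x<y

dbl-<⁻¹ : ∀ {x y} → dbl x <ℤ dbl y → x <ℤ y
dbl-<⁻¹ {x} {y} 2x<2y with <-cmp x y
... | tri< x<y _ _ = x<y
... | tri≈ _ refl _ = ⊥-elim (<-irrefl refl 2x<2y)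
... | tri> _ _ y<x = ⊥-elim (<-asym 2x<2y (dbl-< y<x))

data Side : Set where
  lower upper : Side

nudge : Side → ℤ → ℤ
nudge lower z = pred z
nudge upper z = sucℤ z

<-suc : ∀ z → z <ℤ sucℤ z
<-suc z = suc[i]≤j⇒i<j ≤-refl

pred-< : ∀ z → pred z <ℤ z
pred-< z = i≤pred[j]⇒i<j ≤-refl

nudge-< : ∀ s {x y} → x <ℤ y → nudge s (dbl x) <ℤ dbl y
nudge-< lower x<y = <-trans (pred-< _) (dbl-< x<y)
nudge-< upper {x} {y} x<y = subst (_<ℤ dbl y) (+-assoc 1ℤ x x)
  (<-≤-trans (+-monoʳ-< (sucℤ x) (<-suc x)) (+-mono-≤ 1+x≤y 1+x≤y))
  where 1+x≤y = i<j⇒suc[i]≤j x<y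

<-nudge : ∀ s {x y} → x <ℤ y → dbl x <ℤ nudge s (dbl y)
<-nudge lower {x} {y} x<y = subst (dbl x <ℤ_) (pred-+ y y)
  (≤-<-trans (+-monoˡ-≤ x (i<j⇒i≤pred[j] x<y)) (+-monoʳ-< (pred y) x<y))
<-nudge upper x<y = <-≤-trans (dbl-< x<y) (i≤suc[i] _)

nudge-≢ : ∀ s z → nudge s (dbl z) ≢ dbl z
nudge-≢ lower z = <⇒≢ (pred-< _)
nudge-≢ upper z = ≢-sym (<⇒≢ (<-suc _))

-- the reindexing 0 ↦ 1, k ↦ k: the new origin plays the role of p 1
onto1 : ℕ → ℕ
onto1 zero = 1
onto1 (suc k) = suc k

reseated : (ℕ → ℤ) → Side → ℕ → ℤ
reseated f s zero = nudge s (dbl (f 1))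
reseated f s (suc k) = dbl (f (suc k))

reseated-< : ∀ f s i j → f (onto1 i) <ℤ f (onto1 j) → reseated f s i <ℤ reseated f s j
reseated-< f s zero    zero    l = ⊥-elim (<-irrefl refl l)
reseated-< f s zero    (suc j) l = nudge-< s l
reseated-< f s (suc i) zero    l = <-nudge s l
reseated-< f s (suc i) (suc j) l = dbl-< l

reseated-≢ : ∀ f s i j → f (onto1 i) ≢ f (onto1 j) → reseated f s i ≢ reseated f s j
reseated-≢ f s i j ne with <-cmp (f (onto1 i)) (f (onto1 j))
... | tri< l _ _ = <⇒≢ (reseated-< f s i j l)
... | tri≈ _ e _ = ⊥-elim (ne e)
... | tri> _ _ l = ≢-sym (<⇒≢ (reseated-< f s j i l))

Reflects : (Point → ℤ) → (ℕ → ℕ) → (ℕ → Point) → (ℕ → Point) → Set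
Reflects C g q q′ = ∀ i j → C (q (g i)) <ℤ C (q (g j)) → C (q′ i) <ℤ C (q′ j)

-- g keeps the new point suc k and sends earlier points to earlier points:
-- enough to transfer conditions comparing q (suc k) with all of q 0, …, q k
record Settled (g : ℕ → ℕ) (k : ℕ) : Set where
  field
    new-fixed : g (suc k) ≡ suc k
    old-bounded : ∀ j → j ≤ℕ k → g j ≤ℕ k

-- moreover g keeps q k and sends q j, j < k, before k:
-- enough to transfer the separation conditions as well
record Stable (g : ℕ → ℕ) (k : ℕ) : Set where
  field
    settled : Settled g k
    last-fixed : g k ≡ k
    earlier-bounded : ∀ j → j <ℕ k → g j <ℕ k
  open Settled settled public

SepAlong : (Point → ℤ) → (ℕ → Point) → ℕ → Set
SepAlong C q k =
    (C (q k) <ℤ C (q (suc k)) × (∀ j → j <ℕ k → C (q (suc k)) <ℤ C (q j)))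
  ⊎ (C (q (suc k)) <ℤ C (q k) × (∀ j → j <ℕ k → C (q j) <ℤ C (q (suc k))))

pointwise₁ : ∀ {B P Q : ℕ → Set} → (∀ j → B j → P j × Q j) → ∀ j → B j → P j
pointwise₁ h j b = proj₁ (h j b)

pointwise₂ : ∀ {B P Q : ℕ → Set} → (∀ j → B j → P j × Q j) → ∀ j → B j → Q j
pointwise₂ h j b = proj₂ (h j b)

id-stable : ∀ k → Stable id k
id-stable k = record
  { settled = record { new-fixed = refl ; old-bounded = λ _ j≤k → j≤k }
  ; last-fixed = refl
  ; earlier-bounded = λ _ j<k → j<k }

onto1-settled : ∀ k → Settled onto1 (suc k)
onto1-settled k = record { new-fixed = refl ; old-bounded = bounded }
  where
  bounded : ∀ j → j ≤ℕ suc k → onto1 j ≤ℕ suc k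
  bounded zero    _   = s≤s z≤n
  bounded (suc j) j≤k = j≤k

onto1-stable : ∀ k → Stable onto1 (suc (suc k))
onto1-stable k = record
  { settled = onto1-settled (suc k) ; last-fixed = refl ; earlier-bounded = bounded }
  where
  bounded : ∀ j → j <ℕ suc (suc k) → onto1 j <ℕ suc (suc k)
  bounded zero    _   = s≤s (s≤s z≤n)
  bounded (suc j) j<k = j<k

-- Every pin condition on q at step k (the new point q (suc k) against
-- q 0, …, q k) carries over to q′ when q′ reflects the order of q ∘ g and
-- g is settled resp. stable at k.
module Transfer {q q′ : ℕ → Point} {g : ℕ → ℕ}
                (reflX : Reflects X g q q′) (reflY : Reflects Y g q q′) where

  module Along (C : Point → ℤ) (reflC : Reflects C g q q′) where

    exceeds : ∀ {B : ℕ → Set} {t} → (∀ j → B j → B (g j)) → g t ≡ t →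
              (∀ j → B j → C (q j) <ℤ C (q t)) → ∀ j → B j → C (q′ j) <ℤ C (q′ t)
    exceeds closed gt h j b =
      reflC j _ (subst (λ t → C (q (g j)) <ℤ C (q t)) (sym gt) (h (g j) (closed j b)))

    undercuts : ∀ {B : ℕ → Set} {t} → (∀ j → B j → B (g j)) → g t ≡ t →
                (∀ j → B j → C (q t) <ℤ C (q j)) → ∀ j → B j → C (q′ t) <ℤ C (q′ j)
    undercuts closed gt h j b =
      reflC _ j (subst (λ t → C (q t) <ℤ C (q (g j))) (sym gt) (h (g j) (closed j b)))

    fixed : ∀ {i j} → g i ≡ i → g j ≡ j → C (q i) <ℤ C (q j) → C (q′ i) <ℤ C (q′ j)
    fixed {i} {j} gi gj l = reflC i j (subst₂ (λ a b → C (q a) <ℤ C (q b)) (sym gi) (sym gj) l)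

    sep : ∀ {k} → Stable g k → SepAlong C q k → SepAlong C q′ k
    sep st (inj₁ (l , h)) = inj₁ (fixed last-fixed new-fixed l , undercuts earlier-bounded new-fixed h)
      where open Stable st
    sep st (inj₂ (l , h)) = inj₂ (fixed new-fixed last-fixed l , exceeds earlier-bounded new-fixed h)
      where open Stable st

  module X′ = Along X reflX
  module Y′ = Along Y reflY

  module _ {k : ℕ} (s : Settled g k) where
    open Settled s

    toRight : (∀ j → j ≤ℕ k → X (q j) <ℤ X (q (suc k))) → ∀ j → j ≤ℕ k → X (q′ j) <ℤ X (q′ (suc k))
    toRight = X′.exceeds old-bounded new-fixed

    toLeft : (∀ j → j ≤ℕ k → X (q (suc k)) <ℤ X (q j)) → ∀ j → j ≤ℕ k → X (q′ (suc k)) <ℤ X (q′ j)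
    toLeft = X′.undercuts old-bounded new-fixed

    toTop : (∀ j → j ≤ℕ k → Y (q j) <ℤ Y (q (suc k))) → ∀ j → j ≤ℕ k → Y (q′ j) <ℤ Y (q′ (suc k))
    toTop = Y′.exceeds old-bounded new-fixed

    toBottom : (∀ j → j ≤ℕ k → Y (q (suc k)) <ℤ Y (q j)) → ∀ j → j ≤ℕ k → Y (q′ (suc k)) <ℤ Y (q′ j)
    toBottom = Y′.undercuts old-bounded new-fixed

    outside : Outside q k → Outside q′ k
    outside = ⊎-map toRight (⊎-map toLeft (⊎-map toTop toBottom))

    noSplit : NoSplit q k → NoSplit q′ k
    noSplit (h , v) = ⊎-map toRight toLeft h , ⊎-map toTop toBottom v

    encNum : ∀ c → Enc q k (num c) → Enc q′ k (num c)
    encNum one   h j jk = toRight (pointwise₁ h) j jk , toTop    (pointwise₂ h) j jk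
    encNum two   h j jk = toLeft  (pointwise₁ h) j jk , toTop    (pointwise₂ h) j jk
    encNum three h j jk = toLeft  (pointwise₁ h) j jk , toBottom (pointwise₂ h) j jk
    encNum four  h j jk = toRight (pointwise₁ h) j jk , toBottom (pointwise₂ h) j jk

  module _ {k : ℕ} (st : Stable g k) where
    open Stable st

    sep : Sep q k → Sep q′ k
    sep = ⊎-map (Y′.sep st) (X′.sep st)

    pinStep : Outside q k × (Sep q k ⊎ NoSplit q k) → Outside q′ k × (Sep q′ k ⊎ NoSplit q′ k)
    pinStep (o , s) = outside settled o , ⊎-map sep (noSplit settled) s

    enc : ∀ ℓ → Enc q k ℓ → Enc q′ k ℓ
    enc (num c) h = encNum settled c h
    enc (dir U) (one≤k , h , s) = one≤k , toTop    settled h , X′.sep st s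
    enc (dir D) (one≤k , h , s) = one≤k , toBottom settled h , X′.sep st s
    enc (dir L) (one≤k , h , s) = one≤k , toLeft   settled h , Y′.sep st s
    enc (dir R) (one≤k , h , s) = one≤k , toRight  settled h , Y′.sep st s

numeral-pinStep : ∀ {q k} c → Enc q k (num c) → Outside q k × (Sep q k ⊎ NoSplit q k)
numeral-pinStep one   h = inj₁ (pointwise₁ h) , inj₂ (inj₁ (pointwise₁ h) , inj₁ (pointwise₂ h))
numeral-pinStep two   h = inj₂ (inj₁ (pointwise₁ h)) , inj₂ (inj₂ (pointwise₁ h) , inj₁ (pointwise₂ h))
numeral-pinStep three h = inj₂ (inj₁ (pointwise₁ h)) , inj₂ (inj₂ (pointwise₁ h) , inj₂ (pointwise₂ h))
numeral-pinStep four  h = inj₁ (pointwise₁ h) , inj₂ (inj₁ (pointwise₁ h) , inj₂ (pointwise₂ h))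

-- the side of p 1 on which the origin sits, so that p 1 lies in quadrant a
xSide ySide : Num → Side
xSide one   = lower
xSide two   = upper
xSide three = upper
xSide four  = lower
ySide one   = lower
ySide two   = lower
ySide three = upper
ySide four  = upper

reseat : (ℕ → Point) → Num → ℕ → Point
reseat p a k = reseated (X ∘ p) (xSide a) k , reseated (Y ∘ p) (ySide a) k

reseat-origin : ∀ p a → Enc (reseat p a) 0 (num a)
reseat-origin p one   zero z≤n = pred-< _ , pred-< _
reseat-origin p two   zero z≤n = <-suc _  , pred-< _
reseat-origin p three zero z≤n = <-suc _  , <-suc _
reseat-origin p four  zero z≤n = pred-< _ , <-suc _

-- p′ = reseat p a satisfies every condition of a pin word of π that p does,
-- except the encoding of p 1, which becomes the numeral a
module Reseat (p : ℕ → Point) (a : Num) where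

  p′ : ℕ → Point
  p′ = reseat p a

  module Whole = Transfer {p} {p′} (reseated-< (X ∘ p) (xSide a)) (reseated-< (Y ∘ p) (ySide a))

  -- from position 1 on, p′ is p scaled by 2
  module Tail = Transfer {p ∘ suc} {p′ ∘ suc} {id} (λ _ _ → dbl-<) (λ _ _ → dbl-<)

  apart : ∀ i j → X (p (onto1 i)) ≢ X (p (onto1 j)) × Y (p (onto1 i)) ≢ Y (p (onto1 j))
        → X (p′ i) ≢ X (p′ j) × Y (p′ i) ≢ Y (p′ j)
  apart i j (x≢ , y≢) = reseated-≢ (X ∘ p) (xSide a) i j x≢ , reseated-≢ (Y ∘ p) (ySide a) i j y≢

  genPos : ∀ {n} → 1 ≤ℕ n → GenPos n p → GenPos n p′
  genPos _   gp zero          zero          _   _   0≢0 = ⊥-elim (0≢0 refl)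
  genPos _   gp zero          (suc zero)    _   _   _   = nudge-≢ (xSide a) (X (p 1)) , nudge-≢ (ySide a) (Y (p 1))
  genPos _   gp (suc zero)    zero          _   _   _   = ≢-sym (nudge-≢ (xSide a) (X (p 1))) , ≢-sym (nudge-≢ (ySide a) (Y (p 1)))
  genPos 1≤n gp zero          (suc (suc c)) _   c≤n _   = apart zero (suc (suc c)) (gp 1 _ 1≤n c≤n λ ())
  genPos 1≤n gp (suc (suc c)) zero          c≤n _   _   = apart (suc (suc c)) zero (gp _ 1 c≤n 1≤n λ ())
  genPos _   gp (suc c)       (suc d)       c≤n d≤n c≢d = apart (suc c) (suc d) (gp _ _ c≤n d≤n c≢d)

  orderIso : ∀ {n π} → OrderIso n π p → OrderIso n π p′
  orderIso (σ , iso) = σ , λ i j → let (x→ , →x , y→ , →y) = iso i j in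
    x→ ∘ dbl-<⁻¹ , dbl-< ∘ →x , y→ ∘ dbl-<⁻¹ , dbl-< ∘ →y

  tail-pinSeq : ∀ {n} → IsPinSeq n (p ∘ suc) → IsPinSeq n (p′ ∘ suc)
  tail-pinSeq ps k k<n = Tail.pinStep (id-stable k) (ps k k<n)

  -- the second numeral still encodes p′ 2, since p′ 0 compares with it like p 1
  second : ∀ b → Enc p 1 (num b) → Enc p′ 1 (num b)
  second = Whole.encNum (onto1-settled 0)

  pinSeq : ∀ {n} b → Enc p 1 (num b) → IsPinSeq (suc n) p → IsPinSeq (suc n) p′
  pinSeq b e₁ ps zero          _ = numeral-pinStep a (reseat-origin p a)
  pinSeq b e₁ ps (suc zero)    _ = numeral-pinStep b (second b e₁)
  pinSeq b e₁ ps (suc (suc k)) l = Whole.pinStep (onto1-stable k) (ps _ l)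

  encWord : ∀ k v → EncWord p (suc (suc k)) v → EncWord p′ (suc (suc k)) v
  encWord k []      _        = tt
  encWord k (ℓ ∷ v) (e , es) = Whole.enc (onto1-stable k) ℓ e , encWord (suc k) v es

reorigin : ∀ {n π} a′ {a b v} → InP n π (num a ∷ num b ∷ v) → InP n π (num a′ ∷ num b ∷ v)
reorigin {π = π} a′ {b = b} {v} (p , gp , iso , ps₁ , ps₀ , refl , _ , e₁ , es) =
  p′ , genPos (s≤s z≤n) gp , orderIso {π = π} iso , tail-pinSeq ps₁ , pinSeq b e₁ ps₀ , refl ,
  reseat-origin p a′ , second b e₁ , encWord 0 v es
  where open Reseat p a′

_⊆_ : Lang → Lang → Set
K ⊆ K′ = ∀ {w} → K w → K′ w

·-mono : ∀ {K₁ K₁′ K₂ K₂′} → K₁ ⊆ K₁′ → K₂ ⊆ K₂′ → (K₁ · K₂) ⊆ (K₁′ · K₂′)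
·-mono f g (w₁ , w₂ , w≡ , k₁ , k₂) = w₁ , w₂ , w≡ , f k₁ , g k₂

decomp-dirs : ∀ ds → decomp (dirs ds) ≡ (ds , [])
decomp-dirs []       = refl
decomp-dirs (d ∷ ds) = cong (λ r → d ∷ proj₁ r , proj₂ r) (decomp-dirs ds)

𝓛-strict : ∀ a ds w → 𝓛 (num a ∷ dirs ds) w ≡ (Astar · ⟦ phi a ds ⟧ · Astar) w
𝓛-strict a ds w = cong (λ r → 𝓛F ((a , proj₁ r) ∷ proj₂ r) w) (decomp-dirs ds)

𝓛-quasi : ∀ a b ds w →
  𝓛 (num a ∷ num b ∷ dirs ds) w ≡ (Astar · ⟦ phi a [] ⟧ · Astar · ⟦ phi b ds ⟧ · Astar) w
𝓛-quasi a b ds w = cong (λ r → 𝓛F ((a , []) ∷ (b , proj₁ r) ∷ proj₂ r) w) (decomp-dirs ds)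

phi-M₂ : ∀ a → ⟦ phi a [] ⟧ ⊆ M₂
phi-M₂ one   (here refl)         = here refl
phi-M₂ one   (there (here refl)) = there (there (there (there (here refl))))
phi-M₂ two   (here refl)         = there (here refl)
phi-M₂ two   (there (here refl)) = there (there (there (there (there (there (here refl))))))
phi-M₂ three (here refl)         = there (there (there (here refl)))
phi-M₂ three (there (here refl)) = there (there (there (there (there (there (there (here refl)))))))
phi-M₂ four  (here refl)         = there (there (there (there (there (here refl)))))
phi-M₂ four  (there (here refl)) = there (there (here refl))

M₂-phi : ∀ {m} → M₂ m → Σ Num λ a → ⟦ phi a [] ⟧ m
M₂-phi (here refl)                                                 = one   , here refl
M₂-phi (there (here refl))                                         = two   , here refl
M₂-phi (there (there (here refl)))                                 = four  , there (here refl)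
M₂-phi (there (there (there (here refl))))                         = three , here refl
M₂-phi (there (there (there (there (here refl)))))                 = one   , there (here refl)
M₂-phi (there (there (there (there (there (here refl))))))         = four  , here refl
M₂-phi (there (there (there (there (there (there (here refl)))))))  = two   , there (here refl)
M₂-phi (there (there (there (there (there (there (there (here refl)))))))) = three , there (here refl)

strict-sound : ∀ n π {a ds} → InP n π (num a ∷ dirs ds) →
  𝓛 (num a ∷ dirs ds) ⊆ (Astar · Es n π · Astar)
strict-sound n π {a} {ds} u∈P {w} w∈𝓛 =
  ·-mono id (·-mono (λ m → a , ds , u∈P , m) id) (subst id (𝓛-strict a ds w) w∈𝓛)

quasi-sound : ∀ n π {a b ds} → InP n π (num a ∷ num b ∷ dirs ds) →
  𝓛 (num a ∷ num b ∷ dirs ds) ⊆ (Astar · M₂ · Astar · Eqs n π · Astar)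
quasi-sound n π {a} {b} {ds} u∈P {w} w∈𝓛 =
  ·-mono id (·-mono (phi-M₂ a) (·-mono id (·-mono (λ m → a , b , ds , u∈P , m) id)))
    (subst id (𝓛-quasi a b ds w) w∈𝓛)

strict-complete : ∀ n π → (Astar · Es n π · Astar) ⊆ UnionL n π
strict-complete n π {w} (w₁ , w₂ , w≡ , _ , w₃ , w₄ , w₂≡ , (a , ds , u∈P , m) , _) =
  num a ∷ dirs ds , u∈P , inj₁ (a , ds , refl) ,
  subst id (sym (𝓛-strict a ds w)) (w₁ , w₂ , w≡ , tt , w₃ , w₄ , w₂≡ , m , tt)

-- a word of A⋆ M₂ A⋆ E^qs A⋆ lies in 𝓛 of a quasi-strict pin word whose
-- first numeral is the one selected by the M₂ factor, obtained by reorigin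
quasi-complete : ∀ n π → (Astar · M₂ · Astar · Eqs n π · Astar) ⊆ UnionL n π
quasi-complete n π {w}
  (w₁ , w₂ , w≡ , _ , w₃ , w₄ , w₂≡ , m₂ , w₅ , w₆ , w₄≡ , _ , w₇ , w₈ , w₆≡ , (a , b , ds , u∈P , m) , _)
  with M₂-phi m₂
... | a′ , m′ =
  num a′ ∷ num b ∷ dirs ds , reorigin {π = π} a′ u∈P , inj₂ (a′ , b , ds , refl) ,
  subst id (sym (𝓛-quasi a′ b ds w))
    (w₁ , w₂ , w≡ , tt , w₃ , w₄ , w₂≡ , m′ , w₅ , w₆ , w₄≡ , tt , w₇ , w₈ , w₆≡ , m , tt)

lemmaC4 : (n : ℕ) (π : Permutation′ n) (w : List Dir) →
    (UnionL n π w → (Astar · Es n π · Astar) w ⊎ (Astar · M₂ · Astar · Eqs n π · Astar) w)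
    × ((Astar · Es n π · Astar) w ⊎ (Astar · M₂ · Astar · Eqs n π · Astar) w → UnionL n π w)
lemmaC4 n π w = sound , complete
  where
  sound : UnionL n π w → (Astar · Es n π · Astar) w ⊎ (Astar · M₂ · Astar · Eqs n π · Astar) w
  sound (_ , u∈P , inj₁ (_ , _ , refl) , w∈𝓛)     = inj₁ (strict-sound n π u∈P w∈𝓛)
  sound (_ , u∈P , inj₂ (_ , _ , _ , refl) , w∈𝓛) = inj₂ (quasi-sound n π u∈P w∈𝓛)

  complete : (Astar · Es n π · Astar) w ⊎ (Astar · M₂ · Astar · Eqs n π · Astar) w → UnionL n π w
  complete (inj₁ w∈) = strict-complete n π w∈
  complete (inj₂ w∈) = quasi-complete n π w∈
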